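{- Let $n\ge1$, $k\ge2$, and let $(w_i)_{i=0}^{k^n-1}$ be the $(k,n)$-prefer-max cycle with induced order $\prec$. For any words $x,y$ over $[k]$ with $|x|+|y|=n-1$ and any letters $\sigma_1,\sigma_2\in[k]$ with $0<\sigma_1<\sigma_2$, we have $x\sigma_2y\prec x\sigma_1y$.
   Context: $[k]=\{0,\dots,k-1\}$; words are written by concatenation. The $(k,n)$-prefer-max cycle is the sequence $(w_i)_{i=0}^{k^n-1}$ with $w_0=0^{n-1}(k-1)$ and, if $w_i=\sigma x$ ($\sigma\in[k]$, $x\in[k]^{n-1}$), then $w_{i+1}=x\tau$ where $\tau$ is the maximal letter with $x\tau\notin\{w_0,\dots,w_i\}$. It is known (Martin) that this is well defined for $i<k^n-1$ and that it enumerates each word of $[k]^n$ exactly once. The order $\prec$ on $[k]^n$ is defined by $w_i\prec w_j$ iff $i<j$. -}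

module Defs where

open import Data.Nat using (ℕ; zero; suc; _∸_; _^_; _<_)
open import Data.Fin using (Fin; fromℕ)
open import Data.Fin.Properties using () renaming (_≟_ to _≟ᶠ_)
open import Data.List using (List; []; _∷_; _∷ʳ_; _++_; replicate; drop; reverse; allFin)
open import Data.List.Properties using (≡-dec)
import Data.List.Membership.DecPropositional as DecMem
open import Data.Maybe using (Maybe; just; nothing)
open import Data.Product using (∃₂; _×_)
open import Relation.Nullary using (yes; no)
open import Relation.Binary.PropositionalEquality using (_≡_)

Word : ℕ → Set
Word k = List (Fin k)

firstFree : ∀ {k} → List (Word k) → Word k → List (Fin k) → Maybe (Word k)
firstFree seen x [] = nothing
firstFree {k} seen x (τ ∷ τs) with DecMem._∈?_ (≡-dec (_≟ᶠ_ {k})) (x ∷ʳ τ) seen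
... | yes _ = firstFree seen x τs
... | no  _ = just (x ∷ʳ τ)

nextWord : ∀ {k} → List (Word k) → Word k → Maybe (Word k)
nextWord {k} seen w = firstFree seen (drop 1 w) (reverse (allFin k))

-- Iterate the rule `fuel` times; `seen` is the sequence w_0,…,w_i so far (in order),
-- `w` is its last element.  Stops early if no successor exists.
generate : ∀ {k} → ℕ → List (Word k) → Word k → List (Word k)
generate zero     seen w = seen
generate (suc f) seen w with nextWord seen w
... | nothing = seen
... | just w' = generate f (seen ∷ʳ w') w'

preferMax : (k n : ℕ) → List (Word k)
preferMax zero    n = []
preferMax (suc m) n = generate (suc m ^ n ∸ 1) (w₀ ∷ []) w₀
  where
  w₀ : Word (suc m)
  w₀ = replicate (n ∸ 1) Fin.zero ++ (fromℕ m ∷ [])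

_at_ : ∀ {A : Set} → List A → ℕ → Maybe A
[]       at i     = nothing
(a ∷ as) at zero  = just a
(a ∷ as) at suc i = as at i

_≺[_]_ : ∀ {k} → Word k → ℕ → Word k → Set
_≺[_]_ {k} u n v =
  ∃₂ λ i j → i < j × (preferMax k n at i ≡ just u) × (preferMax k n at j ≡ just v)

-- Read a word ρ v τ as an edge of the de Bruijn graph from its prefix ρ v to its suffix v τ.
-- Every initial segment w₀ … wᵢ of the prefer-max cycle is then a trail from 0ⁿ⁻¹ to the suffix
-- of wᵢ, so out(v) + [v = suffix of wᵢ] = in(v) + [v = 0ⁿ⁻¹] for every vertex v; and since the
-- rule is greedy, the letters τ for which v τ has been used form an upper set.
-- Let 0 < σ₁ < σ₂.  By induction on i, and then on y from the right, x σ₂ y is used as soon as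
-- x σ₁ y is: for y = y′ t the induction hypothesis (for ρ x in place of x) bounds the in-degree
-- of x σ₁ y′ by that of x σ₂ y′, the balance turns this into the same inequality of out-degrees
-- (neither word is 0ⁿ⁻¹), and upper sets of letters are nested according to their size.
-- Hence x σ₂ y precedes x σ₁ y once x σ₁ y occurs at all, and every word occurs by Martin's
-- theorem, which the same degree count reproves: if the rule gets stuck, the balance forces the
-- current suffix to be 0ⁿ⁻¹, and full out-degree then propagates from 0ⁿ⁻¹ to every vertex.

module Submission where

open import Level using (Level)
open import Function using (_∘_; flip)
open import Data.Nat using (ℕ; zero; suc; _+_; _*_; _∸_; _^_; _≤_; _≰_; _<_; z≤n; s≤s; z<s)
open import Data.Nat.Properties
open import Data.Bool using (if_then_else_)
open import Data.Fin using (Fin; toℕ; fromℕ) renaming (zero to fzero; suc to fsuc)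
open import Data.Fin.Properties using (≤fromℕ; toℕ-injective) renaming (_≟_ to _≟ᶠ_; suc-injective to fsuc-injective; <⇒≢ to <⇒≢ᶠ)
open import Data.List using (List; []; _∷_; _∷ʳ_; _++_; [_]; length; replicate; drop; reverse; allFin; map; filter; cartesianProductWith)
open import Data.List.Properties using (≡-dec; ∷-injectiveˡ; ∷-injectiveʳ; ∷ʳ-injective; ∷ʳ-injectiveˡ; ∷ʳ-injectiveʳ; ++-cancelˡ; ++-assoc; ++-identityʳ; unfold-reverse; length-++; length-map; length-tabulate; length-replicate; length-drop; filter-notAll)
open import Data.List.Reverse using (Reverse; []; _∶_∶ʳ_; reverseView)
open import Data.List.Membership.Propositional using (_∈_; _∉_)
open import Data.List.Membership.Propositional.Properties using (∈-++⁺ˡ; ∈-++⁺ʳ; ∈-++⁻; ∈-allFin; ∈-filter⁺; ∈-cartesianProductWith⁺)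
import Data.List.Membership.DecPropositional as DecMembership
open import Data.List.Relation.Binary.Subset.Propositional using (_⊆_)
open import Data.List.Relation.Unary.Any as Any using (Any; here; there)
import Data.List.Relation.Unary.Any.Properties as Anyₚ
open import Data.List.Relation.Unary.All as All using (All; []; _∷_)
open import Data.List.Relation.Unary.AllPairs using (AllPairs; []; _∷_)
import Data.List.Relation.Unary.AllPairs.Properties as AllPairs
open import Data.List.Relation.Unary.Unique.Propositional using (Unique)
import Data.List.Relation.Unary.Unique.Propositional.Properties as Unique
open import Data.Maybe using (just; nothing)
open import Data.Maybe.Properties using (just-injective)
open import Data.Product using (∃-syntax; ∃₂; _×_; _,_; proj₁; proj₂)
open import Data.Sum as Sum using (_⊎_; inj₁; inj₂)
open import Data.Unit using (⊤; tt)
open import Relation.Nullary using (¬_; Dec; yes; no; does; contradiction; ¬?)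
open import Relation.Nullary.Decidable using (dec-true; dec-false)
open import Relation.Unary using (Pred; Decidable) renaming (_⊆_ to _⊆ᵖ_)
open import Relation.Binary using (Rel; DecidableEquality; tri<; tri≈; tri>)
open import Relation.Binary.PropositionalEquality using (_≡_; _≢_; ≢-sym; refl; sym; trans; cong; cong₂; subst; module ≡-Reasoning)
open import Algebra.Properties.CommutativeSemigroup +-commutativeSemigroup using (xy∙z≈xz∙y)

open import Defs

private
  variable
    a ℓ ℓ′ : Level
    A : Set a

-- Counting over Fin k

𝟙 : {P : Set ℓ} → Dec P → ℕ
𝟙 p? = if does p? then 1 else 0

𝟙-yes : {P : Set ℓ} (p? : Dec P) → P → 𝟙 p? ≡ 1
𝟙-yes p? p rewrite dec-true p? p = refl

𝟙-no : {P : Set ℓ} (p? : Dec P) → ¬ P → 𝟙 p? ≡ 0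
𝟙-no p? ¬p rewrite dec-false p? ¬p = refl

𝟙-mono : {P : Set ℓ} {Q : Set ℓ′} → (P → Q) → (p? : Dec P) (q? : Dec Q) → 𝟙 p? ≤ 𝟙 q?
𝟙-mono P⇒Q (yes p) (no ¬q) = contradiction (P⇒Q p) ¬q
𝟙-mono P⇒Q (yes _) (yes _) = ≤-refl
𝟙-mono P⇒Q (no _)  _       = z≤n

𝟙-cong : {P : Set ℓ} {Q : Set ℓ′} → (P → Q) → (Q → P) → (p? : Dec P) (q? : Dec Q) → 𝟙 p? ≡ 𝟙 q?
𝟙-cong P⇒Q Q⇒P p? q? = ≤-antisym (𝟙-mono P⇒Q p? q?) (𝟙-mono Q⇒P q? p?)

𝟙-< : {P : Set ℓ} {Q : Set ℓ′} → ¬ P → Q → (p? : Dec P) (q? : Dec Q) → 𝟙 p? < 𝟙 q?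
𝟙-< ¬p q p? q? rewrite 𝟙-no p? ¬p | 𝟙-yes q? q = z<s

count : ∀ {k} {P : Pred (Fin k) ℓ} → Decidable P → ℕ
count {k = zero}  P? = 0
count {k = suc k} P? = 𝟙 (P? fzero) + count (P? ∘ fsuc)

count-mono : ∀ {k} {P : Pred (Fin k) ℓ} {Q : Pred (Fin k) ℓ′} (P? : Decidable P) (Q? : Decidable Q) →
             P ⊆ᵖ Q → count P? ≤ count Q?
count-mono {k = zero}  P? Q? P⊆Q = z≤n
count-mono {k = suc k} P? Q? P⊆Q =
  +-mono-≤ (𝟙-mono P⊆Q (P? fzero) (Q? fzero)) (count-mono (P? ∘ fsuc) (Q? ∘ fsuc) P⊆Q)

count-mono-< : ∀ {k} {P : Pred (Fin k) ℓ} {Q : Pred (Fin k) ℓ′} (P? : Decidable P) (Q? : Decidable Q) →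
               P ⊆ᵖ Q → ∀ j → ¬ P j → Q j → count P? < count Q?
count-mono-< P? Q? P⊆Q fzero ¬p q =
  +-mono-<-≤ (𝟙-< ¬p q (P? fzero) (Q? fzero)) (count-mono (P? ∘ fsuc) (Q? ∘ fsuc) P⊆Q)
count-mono-< P? Q? P⊆Q (fsuc j) ¬p q =
  +-mono-≤-< (𝟙-mono P⊆Q (P? fzero) (Q? fzero)) (count-mono-< (P? ∘ fsuc) (Q? ∘ fsuc) P⊆Q j ¬p q)

count-cong : ∀ {k} {P : Pred (Fin k) ℓ} {Q : Pred (Fin k) ℓ′} (P? : Decidable P) (Q? : Decidable Q) →
             P ⊆ᵖ Q → Q ⊆ᵖ P → count P? ≡ count Q?
count-cong P? Q? P⊆Q Q⊆P = ≤-antisym (count-mono P? Q? P⊆Q) (count-mono Q? P? Q⊆P)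

count-all : ∀ {k} {P : Pred (Fin k) ℓ} (P? : Decidable P) → (∀ i → P i) → count P? ≡ k
count-all {k = zero}  P? all = refl
count-all {k = suc k} P? all = cong₂ _+_ (𝟙-yes (P? fzero) (all fzero)) (count-all (P? ∘ fsuc) (all ∘ fsuc))

count-none : ∀ {k} {P : Pred (Fin k) ℓ} (P? : Decidable P) → (∀ i → ¬ P i) → count P? ≡ 0
count-none {k = zero}  P? none = refl
count-none {k = suc k} P? none = cong₂ _+_ (𝟙-no (P? fzero) (none fzero)) (count-none (P? ∘ fsuc) (none ∘ fsuc))

count-⊤ : ∀ k → count {k = k} {P = λ _ → ⊤} (λ _ → yes tt) ≡ k
count-⊤ k = count-all (λ _ → yes tt) (λ _ → tt)

count≤k : ∀ {k} {P : Pred (Fin k) ℓ} (P? : Decidable P) → count P? ≤ k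
count≤k {k = k} P? = subst (count P? ≤_) (count-⊤ k) (count-mono P? (λ _ → yes tt) (λ _ → tt))

count<k : ∀ {k} {P : Pred (Fin k) ℓ} (P? : Decidable P) → ∀ j → ¬ P j → count P? < k
count<k {k = k} P? j ¬p = subst (count P? <_) (count-⊤ k) (count-mono-< P? (λ _ → yes tt) (λ _ → tt) j ¬p tt)

count≡k⇒all : ∀ {k} {P : Pred (Fin k) ℓ} (P? : Decidable P) → count P? ≡ k → ∀ i → P i
count≡k⇒all P? count≡k i with P? i
... | yes p  = p
... | no  ¬p = contradiction count≡k (<⇒≢ (count<k P? i ¬p))

count-insert : ∀ {k} {P : Pred (Fin k) ℓ} {Q : Pred (Fin k) ℓ′} (P? : Decidable P) (Q? : Decidable Q) →
               ∀ j → ¬ P j → Q j → P ⊆ᵖ Q → (∀ {i} → Q i → P i ⊎ i ≡ j) → count Q? ≡ suc (count P?)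
count-insert {P = P} {Q = Q} P? Q? fzero ¬p q P⊆Q Q⊆P+j = begin
  𝟙 (Q? fzero) + count (Q? ∘ fsuc)   ≡⟨ cong₂ _+_ (𝟙-yes (Q? fzero) q) (count-cong (Q? ∘ fsuc) (P? ∘ fsuc) Q⊆P P⊆Q) ⟩
  suc (count (P? ∘ fsuc))             ≡⟨ cong (λ z → suc (z + count (P? ∘ fsuc))) (sym (𝟙-no (P? fzero) ¬p)) ⟩
  suc (𝟙 (P? fzero) + count (P? ∘ fsuc)) ∎
  where
  open ≡-Reasoning
  Q⊆P : ∀ {i} → Q (fsuc i) → P (fsuc i)
  Q⊆P q with Q⊆P+j q
  ... | inj₁ p = p
count-insert {P = P} {Q = Q} P? Q? (fsuc j) ¬p q P⊆Q Q⊆P+j = begin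
  𝟙 (Q? fzero) + count (Q? ∘ fsuc)       ≡⟨ cong₂ _+_ (𝟙-cong Q⇒P P⊆Q (Q? fzero) (P? fzero)) shifted ⟩
  𝟙 (P? fzero) + suc (count (P? ∘ fsuc)) ≡⟨ +-suc (𝟙 (P? fzero)) _ ⟩
  suc (𝟙 (P? fzero) + count (P? ∘ fsuc)) ∎
  where
  open ≡-Reasoning
  Q⇒P : Q fzero → P fzero
  Q⇒P q with Q⊆P+j q
  ... | inj₁ p = p
  shifted : count (Q? ∘ fsuc) ≡ suc (count (P? ∘ fsuc))
  shifted = count-insert (P? ∘ fsuc) (Q? ∘ fsuc) j ¬p q P⊆Q (Sum.map₂ fsuc-injective ∘ Q⊆P+j)

∈-∷ʳ⁻ : ∀ {u x} (xs : List A) → u ∈ xs ∷ʳ x → u ∈ xs ⊎ u ≡ x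
∈-∷ʳ⁻ xs u∈ with ∈-++⁻ xs u∈
... | inj₁ u∈xs       = inj₁ u∈xs
... | inj₂ (here u≡x) = inj₂ u≡x

∈-∷ʳ : ∀ (xs : List A) x → x ∈ xs ∷ʳ x
∈-∷ʳ xs x = ∈-++⁺ʳ xs (here refl)

∷ʳ-uncons : ∀ (xs : List A) x → ∃[ y ] xs ∷ʳ x ≡ y ∷ drop 1 (xs ∷ʳ x)
∷ʳ-uncons []      x = x , refl
∷ʳ-uncons (y ∷ _) x = y , refl

replicate-∷ʳ : ∀ n (x : A) → replicate n x ∷ʳ x ≡ x ∷ replicate n x
replicate-∷ʳ zero    x = refl
replicate-∷ʳ (suc n) x = cong (x ∷_) (replicate-∷ʳ n x)

letter-≢ : ∀ (x : List A) {σ₁ σ₂} y → σ₁ ≢ σ₂ → x ++ σ₁ ∷ y ≢ x ++ σ₂ ∷ y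
letter-≢ x y σ₁≢σ₂ eq = σ₁≢σ₂ (∷-injectiveˡ (++-cancelˡ x _ _ eq))

AllPairs-reverse⁺ : ∀ {R : Rel A ℓ} {xs} → AllPairs R xs → AllPairs (flip R) (reverse xs)
AllPairs-reverse⁺ {xs = []}     []          = []
AllPairs-reverse⁺ {xs = x ∷ xs} (Rx ∷ Rxs) rewrite unfold-reverse x xs =
  AllPairs.++⁺ (AllPairs-reverse⁺ Rxs) ([] ∷ []) (All.tabulate λ y∈ → All.lookup Rx (Anyₚ.reverse⁻ y∈) ∷ [])

length-cartesianProductWith : ∀ {b c} {B : Set b} {C : Set c} (f : A → B → C) xs ys →
                              length (cartesianProductWith f xs ys) ≡ length xs * length ys
length-cartesianProductWith f []       ys = refl
length-cartesianProductWith f (x ∷ xs) ys = trans (length-++ (map (f x) ys))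
  (cong₂ _+_ (length-map (f x) ys) (length-cartesianProductWith f xs ys))

module _ (_≟_ : DecidableEquality A) where
  open DecMembership _≟_ using (_∈?_)

  count-∈-∷ʳ-hit : ∀ {k} (f : Fin k → A) {xs x} j → (∀ {i} → f i ≡ f j → i ≡ j) → f j ≡ x → x ∉ xs →
                   count (λ i → f i ∈? xs ∷ʳ x) ≡ count (λ i → f i ∈? xs) + 1
  count-∈-∷ʳ-hit f {xs} {x} j injective-at-j fj≡x x∉xs =
    trans (count-insert (λ i → f i ∈? xs) (λ i → f i ∈? xs ∷ʳ x) j
             (x∉xs ∘ subst (_∈ xs) fj≡x) (subst (_∈ xs ∷ʳ x) (sym fj≡x) (∈-∷ʳ xs x)) ∈-++⁺ˡ
             (Sum.map₂ (λ fi≡x → injective-at-j (trans fi≡x (sym fj≡x))) ∘ ∈-∷ʳ⁻ xs))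
          (+-comm 1 _)

  count-∈-∷ʳ-miss : ∀ {k} (f : Fin k → A) {xs x} → (∀ i → f i ≢ x) →
                    count (λ i → f i ∈? xs ∷ʳ x) ≡ count (λ i → f i ∈? xs)
  count-∈-∷ʳ-miss f {xs} {x} f≢x = count-cong (λ i → f i ∈? xs ∷ʳ x) (λ i → f i ∈? xs) old ∈-++⁺ˡ
    where
    old : ∀ {i} → f i ∈ xs ∷ʳ x → f i ∈ xs
    old {i} fi∈ with ∈-∷ʳ⁻ xs fi∈
    ... | inj₁ fi∈xs = fi∈xs
    ... | inj₂ fi≡x  = contradiction fi≡x (f≢x i)

  length-filter-≢ : ∀ {u} ys → u ∈ ys → length (filter (λ y → ¬? (y ≟ u)) ys) < length ys
  length-filter-≢ {u} ys u∈ys = filter-notAll (λ y → ¬? (y ≟ u)) ys (Any.map (λ { refl y≢u → y≢u refl }) u∈ys)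

  Unique-⊆⇒length≤ : ∀ {xs ys} → Unique xs → xs ⊆ ys → length xs ≤ length ys
  Unique-⊆⇒length≤ {[]}     _              _     = z≤n
  Unique-⊆⇒length≤ {x ∷ xs} {ys} (x∉xs ∷ uxs) xs⊆ys =
    <-≤-trans (s≤s (Unique-⊆⇒length≤ uxs xs⊆ys′)) (length-filter-≢ ys (xs⊆ys (here refl)))
    where
    xs⊆ys′ : xs ⊆ filter (λ y → ¬? (y ≟ x)) ys
    xs⊆ys′ y∈xs = ∈-filter⁺ (λ y → ¬? (y ≟ x)) (xs⊆ys (there y∈xs)) (λ { refl → All.lookup x∉xs y∈xs refl })

  Unique-⊆-length≥⇒⊇ : ∀ {xs ys} → Unique xs → xs ⊆ ys → length ys ≤ length xs → ys ⊆ xs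
  Unique-⊆-length≥⇒⊇ {xs} {ys} uxs xs⊆ys ys≤xs {u} u∈ys with u ∈? xs
  ... | yes u∈xs = u∈xs
  ... | no  u∉xs = contradiction ys≤xs (<⇒≱ (<-≤-trans
          (s≤s (Unique-⊆⇒length≤ uxs xs⊆ys′)) (length-filter-≢ ys u∈ys)))
    where
    xs⊆ys′ : xs ⊆ filter (λ y → ¬? (y ≟ u)) ys
    xs⊆ys′ {y} y∈xs = ∈-filter⁺ (λ y → ¬? (y ≟ u)) (xs⊆ys y∈xs) (λ { refl → u∉xs y∈xs })

Precedes : {A : Set} → List A → A → A → Set
Precedes xs u v = ∃₂ λ i j → i < j × (xs at i ≡ just u) × (xs at j ≡ just v)

at-∷ʳ-< : ∀ {A : Set} (xs : List A) {x} i → i < length xs → (xs ∷ʳ x) at i ≡ xs at i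
at-∷ʳ-< (_ ∷ _)  zero    _         = refl
at-∷ʳ-< (_ ∷ xs) (suc i) (s≤s i<n) = at-∷ʳ-< xs i i<n

at-∷ʳ-length : ∀ {A : Set} (xs : List A) {x} → (xs ∷ʳ x) at length xs ≡ just x
at-∷ʳ-length []       = refl
at-∷ʳ-length (_ ∷ xs) = at-∷ʳ-length xs

at⇒< : ∀ {A : Set} (xs : List A) {u} i → xs at i ≡ just u → i < length xs
at⇒< (_ ∷ _)  zero    _  = z<s
at⇒< (_ ∷ xs) (suc i) eq = s≤s (at⇒< xs i eq)

∈⇒at : ∀ {A : Set} {u} (xs : List A) → u ∈ xs → ∃[ i ] xs at i ≡ just u
∈⇒at (_ ∷ _)  (here refl) = zero , refl
∈⇒at (_ ∷ xs) (there u∈)  with i , eq ← ∈⇒at xs u∈ = suc i , eq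

Precedes-∷ʳ : ∀ {A : Set} {xs : List A} {x u v} → Precedes xs u v → Precedes (xs ∷ʳ x) u v
Precedes-∷ʳ {xs = xs} (i , j , i<j , xsᵢ , xsⱼ) =
  i , j , i<j , trans (at-∷ʳ-< xs i (at⇒< xs i xsᵢ)) xsᵢ , trans (at-∷ʳ-< xs j (at⇒< xs j xsⱼ)) xsⱼ

∈⇒Precedes-∷ʳ : ∀ {A : Set} {xs : List A} {x u} → u ∈ xs → Precedes (xs ∷ʳ x) u x
∈⇒Precedes-∷ʳ {xs = xs} u∈ with i , xsᵢ ← ∈⇒at xs u∈ =
  i , length xs , at⇒< xs i xsᵢ , trans (at-∷ʳ-< xs i (at⇒< xs i xsᵢ)) xsᵢ , at-∷ʳ-length xs

firstFree-just : ∀ {k} (seen : List (Word k)) x {τs r} → AllPairs (λ σ τ → toℕ τ < toℕ σ) τs →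
                 firstFree seen x τs ≡ just r →
                 ∃[ τ ] r ≡ x ∷ʳ τ × x ∷ʳ τ ∉ seen × (∀ {τ′} → τ′ ∈ τs → toℕ τ < toℕ τ′ → x ∷ʳ τ′ ∈ seen)
firstFree-just {k} seen x {τ ∷ τs} (τ>τs ∷ desc) eq with DecMembership._∈?_ (≡-dec (_≟ᶠ_ {k})) (x ∷ʳ τ) seen
... | yes xτ∈ with τ₀ , r≡ , fresh , greedy ← firstFree-just seen x desc eq =
  τ₀ , r≡ , fresh , λ { (here refl) _ → xτ∈ ; (there τ′∈) → greedy τ′∈ }
... | no xτ∉ = τ , sym (just-injective eq) , xτ∉ , λ
  { (here refl) τ<τ  → contradiction τ<τ (<-irrefl refl)
  ; (there τ′∈) τ<τ′ → contradiction (All.lookup τ>τs τ′∈) (<-asym τ<τ′) }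

firstFree-nothing : ∀ {k} (seen : List (Word k)) x {τs} → firstFree seen x τs ≡ nothing →
                    ∀ {τ} → τ ∈ τs → x ∷ʳ τ ∈ seen
firstFree-nothing {k} seen x {τ ∷ τs} eq τ′∈ with DecMembership._∈?_ (≡-dec (_≟ᶠ_ {k})) (x ∷ʳ τ) seen
firstFree-nothing seen x eq (here refl) | yes xτ∈ = xτ∈
firstFree-nothing seen x eq (there τ′∈) | yes _   = firstFree-nothing seen x eq τ′∈
firstFree-nothing seen x () _           | no _

candidates-descending : ∀ k → AllPairs (λ σ τ → toℕ τ < toℕ σ) (reverse (allFin k))
candidates-descending k = AllPairs-reverse⁺ (AllPairs.tabulate⁺-< (λ i<j → i<j))

words : ∀ k → ℕ → List (Word k)
words k zero    = [ [] ]
words k (suc j) = cartesianProductWith _∷_ (allFin k) (words k j)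

length-words : ∀ k j → length (words k j) ≡ k ^ j
length-words k zero    = refl
length-words k (suc j) = trans (length-cartesianProductWith _∷_ (allFin k) (words k j))
  (cong₂ _*_ (length-tabulate {n = k} (λ i → i)) (length-words k j))

∈-words : ∀ {k} (u : Word k) → u ∈ words k (length u)
∈-words []      = here refl
∈-words (σ ∷ u) = ∈-cartesianProductWith⁺ _∷_ (∈-allFin σ) (∈-words u)

nonzero-letter-≢-zeros : ∀ {k} (x : Word (suc k)) {σ} y j → 0 < toℕ σ → x ++ σ ∷ y ≢ replicate j fzero
nonzero-letter-≢-zeros []      y zero    0<σ ()
nonzero-letter-≢-zeros (_ ∷ _) y zero    0<σ ()
nonzero-letter-≢-zeros []      y (suc j) 0<σ eq with refl ← ∷-injectiveˡ eq = n≮n 0 0<σ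
nonzero-letter-≢-zeros (_ ∷ x) y (suc j) 0<σ eq = nonzero-letter-≢-zeros x y j 0<σ (∷-injectiveʳ eq)

-- The prefer-max cycle

-- k = suc m and n = suc d, so that w₀ = 0ⁿ⁻¹ (k − 1) unfolds definitionally.
module PreferMax (m d : ℕ) where

  K : ℕ
  K = suc m

  n : ℕ
  n = suc d

  W : Set
  W = Word K

  _≟ʷ_ : DecidableEquality W
  _≟ʷ_ = ≡-dec _≟ᶠ_

  open DecMembership _≟ʷ_ using (_∈?_)

  zeros : W
  zeros = replicate d fzero

  outdeg : List W → W → ℕ
  outdeg L v = count (λ τ → v ∷ʳ τ ∈? L)

  indeg : List W → W → ℕ
  indeg L v = count (λ ρ → ρ ∷ v ∈? L)

  δ : W → W → ℕ
  δ u v = 𝟙 (u ≟ʷ v)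

  δ-refl : ∀ u → δ u u ≡ 1
  δ-refl u = 𝟙-yes (u ≟ʷ u) refl

  δ-≢ : ∀ {u v} → u ≢ v → δ u v ≡ 0
  δ-≢ {u} {v} = 𝟙-no (u ≟ʷ v)

  Upward : List W → Set
  Upward L = ∀ v {τ τ′} → v ∷ʳ τ ∈ L → toℕ τ < toℕ τ′ → v ∷ʳ τ′ ∈ L

  Balanced : List W → W → Set
  Balanced L c = ∀ v → outdeg L v + δ v c ≡ indeg L v + δ v zeros

  RaiseClosed : List W → Set
  RaiseClosed L = ∀ x y σ₁ σ₂ → 0 < toℕ σ₁ → toℕ σ₁ < toℕ σ₂ →
                  x ++ σ₁ ∷ y ∈ L → x ++ σ₂ ∷ y ∈ L

  RaisePrecedes : List W → Set
  RaisePrecedes L = ∀ x y σ₁ σ₂ → 0 < toℕ σ₁ → toℕ σ₁ < toℕ σ₂ →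
                    x ++ σ₁ ∷ y ∈ L → Precedes L (x ++ σ₂ ∷ y) (x ++ σ₁ ∷ y)

  record Invariant (L : List W) (cw : W) : Set where
    field
      length-current : length cw ≡ n
      length-∈       : ∀ {u} → u ∈ L → length u ≡ n
      unique         : Unique L
      upward         : Upward L
      balanced       : Balanced L (drop 1 cw)
      raise-closed   : RaiseClosed L
      raise-precedes : RaisePrecedes L

  module _ {L} (upward : Upward L) where

    ∷ʳ-fzero-∈⇒∷ʳ-∈ : ∀ v → v ∷ʳ fzero ∈ L → ∀ τ → v ∷ʳ τ ∈ L
    ∷ʳ-fzero-∈⇒∷ʳ-∈ v v0∈ fzero    = v0∈
    ∷ʳ-fzero-∈⇒∷ʳ-∈ v v0∈ (fsuc τ) = upward v v0∈ z<s

    outdeg-≤⇒∷ʳ-∈ : ∀ {u₁ u₂ t} → outdeg L u₁ ≤ outdeg L u₂ → u₁ ∷ʳ t ∈ L → u₂ ∷ʳ t ∈ L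
    outdeg-≤⇒∷ʳ-∈ {u₁} {u₂} {t} out≤ u₁t∈ with u₂ ∷ʳ t ∈? L
    ... | yes u₂t∈ = u₂t∈
    ... | no  u₂t∉ = contradiction out≤
          (<⇒≱ (count-mono-< (λ τ → u₂ ∷ʳ τ ∈? L) (λ τ → u₁ ∷ʳ τ ∈? L) u₂⊆u₁ t u₂t∉ u₁t∈))
      where
      u₂⊆u₁ : ∀ {τ} → u₂ ∷ʳ τ ∈ L → u₁ ∷ʳ τ ∈ L
      u₂⊆u₁ {τ} u₂τ∈ with <-cmp (toℕ τ) (toℕ t)
      ... | tri< τ<t _ _ = contradiction (upward u₂ u₂τ∈ τ<t) u₂t∉
      ... | tri≈ _ τ≡t _ = contradiction (subst (λ σ → u₂ ∷ʳ σ ∈ L) (toℕ-injective τ≡t) u₂τ∈) u₂t∉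
      ... | tri> _ _ t<τ = upward u₁ u₁t∈ t<τ

  module _ {L c} (balanced : Balanced L c) where

    balanced-≢-zeros : ∀ {u} → u ≢ zeros → outdeg L u + δ u c ≡ indeg L u
    balanced-≢-zeros {u} u≢0 = trans (balanced u) (trans (cong (indeg L u +_) (δ-≢ u≢0)) (+-identityʳ _))

    outdeg-mono : ∀ {u₁ u₂} → u₁ ≢ zeros → u₂ ≢ zeros → δ u₂ c + indeg L u₁ ≤ indeg L u₂ →
                  outdeg L u₁ ≤ outdeg L u₂
    outdeg-mono {u₁} {u₂} u₁≢0 u₂≢0 gap = +-cancelˡ-≤ (δ u₂ c) _ _ (begin
      δ u₂ c + outdeg L u₁              ≤⟨ +-monoʳ-≤ (δ u₂ c) (m≤m+n (outdeg L u₁) (δ u₁ c)) ⟩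
      δ u₂ c + (outdeg L u₁ + δ u₁ c)   ≡⟨ cong (δ u₂ c +_) (balanced-≢-zeros u₁≢0) ⟩
      δ u₂ c + indeg L u₁               ≤⟨ gap ⟩
      indeg L u₂                        ≡⟨ sym (balanced-≢-zeros u₂≢0) ⟩
      outdeg L u₂ + δ u₂ c              ≡⟨ +-comm (outdeg L u₂) (δ u₂ c) ⟩
      δ u₂ c + outdeg L u₂              ∎)
      where open ≤-Reasoning

  module Step {L cw} (I : Invariant L cw) (τ₀ : Fin K)
              (fresh : drop 1 cw ∷ʳ τ₀ ∉ L)
              (greedy : ∀ {τ} → toℕ τ₀ < toℕ τ → drop 1 cw ∷ʳ τ ∈ L) where
    open Invariant I

    c : W
    c = drop 1 cw

    w : W
    w = c ∷ʳ τ₀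

    L′ : List W
    L′ = L ∷ʳ w

    c′ : W
    c′ = drop 1 w

    ρ₀ : Fin K
    ρ₀ = proj₁ (∷ʳ-uncons c τ₀)

    w≡ρ₀∷c′ : w ≡ ρ₀ ∷ c′
    w≡ρ₀∷c′ = proj₂ (∷ʳ-uncons c τ₀)

    length-w : length w ≡ n
    length-w = trans (length-++ c)
      (trans (cong (_+ 1) (trans (length-drop 1 cw) (cong (_∸ 1) length-current))) (+-comm d 1))

    length-∈′ : ∀ {u} → u ∈ L′ → length u ≡ n
    length-∈′ u∈ with ∈-∷ʳ⁻ L u∈
    ... | inj₁ u∈L = length-∈ u∈L
    ... | inj₂ refl = length-w

    unique′ : Unique L′
    unique′ = Unique.++⁺ unique ([] ∷ []) (λ { (w∈L , here refl) → fresh w∈L })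

    upward′ : Upward L′
    upward′ v {τ} vτ∈ τ<τ′ with ∈-∷ʳ⁻ L vτ∈
    ... | inj₁ vτ∈L = ∈-++⁺ˡ (upward v vτ∈L τ<τ′)
    ... | inj₂ vτ≡w with refl , refl ← ∷ʳ-injective v c vτ≡w = ∈-++⁺ˡ (greedy τ<τ′)

    outdeg-∷ʳ : ∀ v → outdeg L′ v ≡ outdeg L v + δ v c
    outdeg-∷ʳ v with v ≟ʷ c
    ... | yes refl = count-∈-∷ʳ-hit _≟ʷ_ (v ∷ʳ_) τ₀ (∷ʳ-injectiveʳ v v) refl fresh
    ... | no v≢c = trans (count-∈-∷ʳ-miss _≟ʷ_ (v ∷ʳ_) (λ τ vτ≡w → v≢c (∷ʳ-injectiveˡ v c vτ≡w)))
                         (sym (+-identityʳ _))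

    indeg-∷ʳ : ∀ v → indeg L′ v ≡ indeg L v + δ v c′
    indeg-∷ʳ v with v ≟ʷ c′
    ... | yes refl = count-∈-∷ʳ-hit _≟ʷ_ (_∷ v) ρ₀ ∷-injectiveˡ (sym w≡ρ₀∷c′) fresh
    ... | no v≢c′ = trans (count-∈-∷ʳ-miss _≟ʷ_ (_∷ v) (λ ρ ρv≡w → v≢c′ (∷-injectiveʳ (trans ρv≡w w≡ρ₀∷c′))))
                          (sym (+-identityʳ _))

    balanced′ : Balanced L′ c′
    balanced′ v = begin
      outdeg L′ v + δ v c′              ≡⟨ cong (_+ δ v c′) (outdeg-∷ʳ v) ⟩
      outdeg L v + δ v c + δ v c′       ≡⟨ cong (_+ δ v c′) (balanced v) ⟩
      indeg L v + δ v zeros + δ v c′    ≡⟨ xy∙z≈xz∙y (indeg L v) (δ v zeros) (δ v c′) ⟩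
      indeg L v + δ v c′ + δ v zeros    ≡⟨ cong (_+ δ v zeros) (sym (indeg-∷ʳ v)) ⟩
      indeg L′ v + δ v zeros            ∎
      where open ≡-Reasoning

    -- If u₂ is the current suffix its balance has an extra 1; it is paid for by the edge ρ₀ u₂ just
    -- added, which has no counterpart ρ₀ u₁.
    indeg-gap : ∀ {u₁ u₂} → (∀ {ρ} → ρ ∷ u₁ ∈ L′ → ρ ∷ u₂ ∈ L′) → (u₂ ≡ c′ → ρ₀ ∷ u₁ ∉ L′) →
                δ u₂ c′ + indeg L′ u₁ ≤ indeg L′ u₂
    indeg-gap {u₁} {u₂} in⊆ gap with u₂ ≟ʷ c′
    ... | yes refl = count-mono-< (λ ρ → ρ ∷ u₁ ∈? L′) (λ ρ → ρ ∷ u₂ ∈? L′) in⊆ ρ₀ (gap refl)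
                                  (subst (_∈ L′) w≡ρ₀∷c′ (∈-∷ʳ L w))
    ... | no _     = count-mono (λ ρ → ρ ∷ u₁ ∈? L′) (λ ρ → ρ ∷ u₂ ∈? L′) in⊆

    raise-closed′ : RaiseClosed L′
    raise-closed′ x y σ₁ σ₂ 0<σ₁ σ₁<σ₂ = go (reverseView y) x
      where
      go : ∀ {y} → Reverse y → ∀ x → x ++ σ₁ ∷ y ∈ L′ → x ++ σ₂ ∷ y ∈ L′
      go []              x xσ₁∈ = upward′ x xσ₁∈ σ₁<σ₂
      go (v ∶ rv ∶ʳ t) x xσ₁vt∈ =
        subst (_∈ L′) (++-assoc x (σ₂ ∷ v) [ t ])
          (outdeg-≤⇒∷ʳ-∈ upward′
            (outdeg-mono balanced′ (nonzero-letter-≢-zeros x v d 0<σ₁)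
                                   (nonzero-letter-≢-zeros x v d (<-trans 0<σ₁ σ₁<σ₂))
                                   (indeg-gap (λ {ρ} → go rv (ρ ∷ x)) gap))
            (subst (_∈ L′) (sym (++-assoc x (σ₁ ∷ v) [ t ])) xσ₁vt∈))
        where
        gap : x ++ σ₂ ∷ v ≡ c′ → ρ₀ ∷ x ++ σ₁ ∷ v ∉ L′
        gap u₂≡c′ ρ₀u₁∈ with ∈-∷ʳ⁻ L ρ₀u₁∈
        ... | inj₁ ρ₀u₁∈L = fresh (subst (_∈ L) (sym w≡ρ₀u₂) (raise-closed (ρ₀ ∷ x) v σ₁ σ₂ 0<σ₁ σ₁<σ₂ ρ₀u₁∈L))
          where
          w≡ρ₀u₂ : w ≡ ρ₀ ∷ x ++ σ₂ ∷ v
          w≡ρ₀u₂ = trans w≡ρ₀∷c′ (cong (ρ₀ ∷_) (sym u₂≡c′))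
        ... | inj₂ ρ₀u₁≡w = letter-≢ x v (<⇒≢ᶠ σ₁<σ₂)
          (∷-injectiveʳ (trans ρ₀u₁≡w (trans w≡ρ₀∷c′ (cong (ρ₀ ∷_) (sym u₂≡c′)))))

    raise-precedes′ : RaisePrecedes L′
    raise-precedes′ x y σ₁ σ₂ 0<σ₁ σ₁<σ₂ xσ₁y∈ with ∈-∷ʳ⁻ L xσ₁y∈
    ... | inj₁ xσ₁y∈L = Precedes-∷ʳ {xs = L} (raise-precedes x y σ₁ σ₂ 0<σ₁ σ₁<σ₂ xσ₁y∈L)
    ... | inj₂ xσ₁y≡w with ∈-∷ʳ⁻ L (raise-closed′ x y σ₁ σ₂ 0<σ₁ σ₁<σ₂ xσ₁y∈)
    ...   | inj₁ xσ₂y∈L = subst (Precedes L′ _) (sym xσ₁y≡w) (∈⇒Precedes-∷ʳ {xs = L} xσ₂y∈L)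
    ...   | inj₂ xσ₂y≡w = contradiction (trans xσ₂y≡w (sym xσ₁y≡w)) (letter-≢ x y (≢-sym (<⇒≢ᶠ σ₁<σ₂)))

    invariant : Invariant L′ w
    invariant = record
      { length-current = length-w
      ; length-∈       = length-∈′
      ; unique         = unique′
      ; upward         = upward′
      ; balanced       = balanced′
      ; raise-closed   = raise-closed′
      ; raise-precedes = raise-precedes′
      }

  -- The cycle proceeds as if started from 0ⁿ, whose greedy successor is w₀.
  invariant-[] : Invariant [] (fzero ∷ zeros)
  invariant-[] = record
    { length-current = cong suc (length-replicate d)
    ; length-∈       = λ ()
    ; upward         = λ _ ()
    ; unique         = []
    ; balanced       = λ v → cong (_+ δ v zeros)
        (trans (count-none (λ τ → v ∷ʳ τ ∈? []) (λ _ ())) (sym (count-none (λ ρ → ρ ∷ v ∈? []) (λ _ ()))))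
    ; raise-closed   = λ _ _ _ _ _ _ ()
    ; raise-precedes = λ _ _ _ _ _ _ ()
    }

  invariant-initial : Invariant [ zeros ∷ʳ fromℕ m ] (zeros ∷ʳ fromℕ m)
  invariant-initial = Step.invariant invariant-[] (fromℕ m) (λ ())
    (λ {τ} top<τ → contradiction (≤fromℕ τ) (<⇒≱ top<τ))

  step : ∀ {L cw w} → Invariant L cw → nextWord L cw ≡ just w → Invariant (L ∷ʳ w) w
  step {L} {cw} I next≡w
    with τ₀ , refl , fresh , greedy ← firstFree-just L (drop 1 cw) (candidates-descending K) next≡w
    = Step.invariant I τ₀ fresh (λ {τ} → greedy (Anyₚ.reverse⁺ (∈-allFin τ)))

  generate-invariant : ∀ f {L cw} → Invariant L cw →
    ∃[ cw′ ] Invariant (generate f L cw) cw′ ×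
             (nextWord (generate f L cw) cw′ ≡ nothing ⊎ length (generate f L cw) ≡ length L + f)
  generate-invariant zero    {cw = cw} I = cw , I , inj₂ (sym (+-identityʳ _))
  generate-invariant (suc f) {L} {cw} I with nextWord L cw in next≡
  ... | nothing = cw , I , inj₁ next≡
  ... | just w with generate-invariant f (step I next≡)
  ...   | cw′ , I′ , inj₁ stuck = cw′ , I′ , inj₁ stuck
  ...   | cw′ , I′ , inj₂ len   =
          cw′ , I′ , inj₂ (trans len (trans (cong (_+ f) (length-++ L)) (+-assoc (length L) 1 f)))

  module Saturated {R cw} (I : Invariant R cw) (saturated : ∀ τ → drop 1 cw ∷ʳ τ ∈ R) where
    open Invariant I

    c : W
    c = drop 1 cw

    c≡zeros : c ≡ zeros
    c≡zeros with c ≟ʷ zeros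
    ... | yes c≡0 = c≡0
    ... | no  c≢0 = contradiction (count≤k (λ ρ → ρ ∷ c ∈? R)) (subst (_≰ K) (sym indeg≡1+K) 1+n≰n)
      where
      indeg≡1+K : indeg R c ≡ suc K
      indeg≡1+K = begin
        indeg R c           ≡⟨ sym (balanced-≢-zeros balanced c≢0) ⟩
        outdeg R c + δ c c  ≡⟨ cong₂ _+_ (count-all (λ τ → c ∷ʳ τ ∈? R) saturated) (δ-refl c) ⟩
        K + 1               ≡⟨ +-comm K 1 ⟩
        suc K               ∎
        where open ≡-Reasoning

    outdeg≡indeg : ∀ u → outdeg R u ≡ indeg R u
    outdeg≡indeg u = +-cancelʳ-≡ (δ u zeros) _ _
      (subst (λ z → outdeg R u + δ u z ≡ indeg R u + δ u zeros) c≡zeros (balanced u))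

    zeros-suffix-saturated : ∀ p j → length p + j ≡ d → ∀ τ → (p ++ replicate j fzero) ∷ʳ τ ∈ R
    zeros-suffix-saturated []      j refl τ = subst (λ v → v ∷ʳ τ ∈ R) c≡zeros (saturated τ)
    zeros-suffix-saturated (σ ∷ p) j |σp|+j≡d = ∷ʳ-fzero-∈⇒∷ʳ-∈ upward (σ ∷ p ++ replicate j fzero) (subst (_∈ R) shift σu∈)
      where
      u : W
      u = p ++ replicate (suc j) fzero

      u-saturated : ∀ τ → u ∷ʳ τ ∈ R
      u-saturated = zeros-suffix-saturated p (suc j) (trans (+-suc (length p) j) |σp|+j≡d)

      σu∈ : σ ∷ u ∈ R
      σu∈ = count≡k⇒all (λ ρ → ρ ∷ u ∈? R)
        (trans (sym (outdeg≡indeg u)) (count-all (λ τ → u ∷ʳ τ ∈? R) u-saturated)) σ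

      shift : σ ∷ u ≡ (σ ∷ p ++ replicate j fzero) ∷ʳ fzero
      shift = cong (σ ∷_) (trans (cong (p ++_) (sym (replicate-∷ʳ j fzero)))
                                 (sym (++-assoc p (replicate j fzero) [ fzero ])))

    complete : ∀ u → length u ≡ n → u ∈ R
    complete u |u|≡n with reverseView u
    ... | []         = contradiction |u|≡n (λ ())
    ... | p ∶ _ ∶ʳ t = subst (λ v → v ∷ʳ t ∈ R) (++-identityʳ p)
                         (zeros-suffix-saturated p 0 (trans (+-identityʳ _) |p|≡d) t)
      where
      |p|≡d : length p ≡ d
      |p|≡d = suc-injective (trans (+-comm 1 (length p)) (trans (sym (length-++ p)) |u|≡n))

  complete-full : ∀ {R cw} → Invariant R cw → length R ≡ K ^ n → ∀ u → length u ≡ n → u ∈ R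
  complete-full {R} I |R|≡Kⁿ u |u|≡n =
    Unique-⊆-length≥⇒⊇ _≟ʷ_ unique R⊆words (≤-reflexive (trans (length-words K n) (sym |R|≡Kⁿ)))
      (subst (λ j → u ∈ words K j) |u|≡n (∈-words u))
    where
    open Invariant I
    R⊆words : ∀ {v} → v ∈ R → v ∈ words K n
    R⊆words {v} v∈R = subst (λ j → v ∈ words K j) (length-∈ v∈R) (∈-words v)

  complete : ∀ {R cw} → Invariant R cw → nextWord R cw ≡ nothing ⊎ length R ≡ K ^ n →
             ∀ u → length u ≡ n → u ∈ R
  complete I (inj₁ stuck) = Saturated.complete I
    (λ τ → firstFree-nothing _ _ stuck (Anyₚ.reverse⁺ (∈-allFin τ)))
  complete I (inj₂ full)  = complete-full I full

  preferMax-invariant : ∃[ cw ] Invariant (preferMax K n) cw × (∀ u → length u ≡ n → u ∈ preferMax K n)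
  preferMax-invariant with cw , I , ending ← generate-invariant (K ^ n ∸ 1) invariant-initial
    = cw , I , complete I (Sum.map₂ (λ len → trans len (m+[n∸m]≡n (m^n>0 K n))) ending)

  preferMax-raise-precedes : ∀ x y σ₁ σ₂ → length x + length y ≡ d → 0 < toℕ σ₁ → toℕ σ₁ < toℕ σ₂ →
                             Precedes (preferMax K n) (x ++ σ₂ ∷ y) (x ++ σ₁ ∷ y)
  preferMax-raise-precedes x y σ₁ σ₂ |x|+|y|≡d 0<σ₁ σ₁<σ₂
    with _ , I , all-words ← preferMax-invariant
    = Invariant.raise-precedes I x y σ₁ σ₂ 0<σ₁ σ₁<σ₂
        (all-words _ (trans (length-++ x) (trans (+-suc (length x) (length y)) (cong suc |x|+|y|≡d))))

proposition3 : (n k : ℕ) → 1 ≤ n → 2 ≤ k →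
    (x y : List (Fin k)) → suc (length x + length y) ≡ n →
    (σ₁ σ₂ : Fin k) → 0 < toℕ σ₁ → toℕ σ₁ < toℕ σ₂ →
    (x ++ σ₂ ∷ y) ≺[ n ] (x ++ σ₁ ∷ y)
-- The proof only needs k ≥ 1.
proposition3 (suc d) (suc m) _ _ x y |x|+|y|+1≡n σ₁ σ₂ 0<σ₁ σ₁<σ₂ =
  PreferMax.preferMax-raise-precedes m d x y σ₁ σ₂ (suc-injective |x|+|y|+1≡n) 0<σ₁ σ₁<σ₂
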